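{- For $\sigma\in S_n$ let $\mu^3(\sigma)$ denote the minimal $k$ such that there exist $3$-cycles $\delta_1,\dots,\delta_k\in S_n$ with $\delta_1\cdots\delta_k=\sigma$ and such that the group generated by $\delta_1,\dots,\delta_k$ acts transitively on $\{1,\dots,n\}$. If $n$ is odd and $\sigma=(n\ \ n-1\ \ n-2\ \cdots\ 2\ \ 1)$, then $\mu^3(\sigma)=\frac{n-1}{2}$. If $n\ge 4$ is even and $\tilde\sigma=(n\ \ n-1)(n-2\ \ n-3\ \cdots\ 2\ \ 1)$, then $\mu^3(\tilde\sigma)=\frac{n}{2}$.
   Context: Products of permutations are composed right to left, and a cycle $(a_1\ a_2\ \cdots\ a_r)$ sends $a_1\mapsto a_2\mapsto\cdots\mapsto a_r\mapsto a_1$. An empty product (k=0) is the identity. -}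

module Defs where

open import Data.Nat using (ℕ; zero; suc; _+_; _≤_)
open import Data.Fin using (Fin; zero; suc; fromℕ; inject₁; splitAt; _↑ˡ_; _↑ʳ_)
open import Data.Fin.Permutation using (Permutation′; _⟨$⟩ʳ_; _⟨$⟩ˡ_)
open import Data.Vec using (Vec; []; _∷_; lookup)
open import Data.Vec.Relation.Unary.All using (All)
open import Data.Product using (Σ; ∃; _×_)
open import Data.Sum using ([_,_]′)
open import Relation.Binary.PropositionalEquality using (_≡_; _≢_)

IsThreeCycle : ∀ {n} → Permutation′ n → Set
IsThreeCycle {n} π =
  Σ (Fin n) λ a → Σ (Fin n) λ b → Σ (Fin n) λ c →
    (a ≢ b) × (b ≢ c) × (a ≢ c) ×
    (π ⟨$⟩ʳ a ≡ b) × (π ⟨$⟩ʳ b ≡ c) × (π ⟨$⟩ʳ c ≡ a) ×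
    (∀ x → x ≢ a → x ≢ b → x ≢ c → π ⟨$⟩ʳ x ≡ x)

-- Action of the product δ₁ ⋯ δ_k, composed right to left:
-- (δ₁ ⋯ δ_k)(x) = δ₁ (δ₂ ( ⋯ (δ_k x))). Empty product = identity.
prodAct : ∀ {n k} → Vec (Permutation′ n) k → Fin n → Fin n
prodAct []       x = x
prodAct (δ ∷ ds) x = δ ⟨$⟩ʳ prodAct ds x

-- y lies in the orbit of x under the group generated by the δ's
-- (elements of that group are words in the δ's and their inverses).
data Reach {n k} (ds : Vec (Permutation′ n) k) : Fin n → Fin n → Set where
  here : ∀ {x} → Reach ds x x
  fwd  : ∀ {x y} (i : Fin k) → Reach ds (lookup ds i ⟨$⟩ʳ x) y → Reach ds x y
  bwd  : ∀ {x y} (i : Fin k) → Reach ds (lookup ds i ⟨$⟩ˡ x) y → Reach ds x y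

GenTransitive : ∀ {n k} → Vec (Permutation′ n) k → Set
GenTransitive {n} ds = ∀ (x y : Fin n) → Reach ds x y

Achievable : ∀ {n} → (Fin n → Fin n) → ℕ → Set
Achievable {n} σ k =
  Σ (Vec (Permutation′ n) k) λ ds →
    All IsThreeCycle ds × (∀ x → prodAct ds x ≡ σ x) × GenTransitive ds

Mu3Is : ∀ {n} → (Fin n → Fin n) → ℕ → Set
Mu3Is σ k = Achievable σ k × (∀ j → Achievable σ j → k ≤ j)

-- The cycle (n n-1 ⋯ 2 1) on Fin n (0-based: i+1 ↦ i, 0 ↦ n-1).
downCycle : ∀ {n} → Fin n → Fin n
downCycle {suc m} zero    = fromℕ m
downCycle {suc m} (suc i) = inject₁ i

swap2 : Fin 2 → Fin 2
swap2 zero       = suc zero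
swap2 (suc zero) = zero

-- σ̃ = (n n-1)(n-2 ⋯ 2 1) on Fin (m + 2), n = m + 2.
tildeSigma : ∀ {m} → Fin (m + 2) → Fin (m + 2)
tildeSigma {m} x = [ (λ i → downCycle i ↑ˡ 2) , (λ j → m ↑ʳ swap2 j) ]′ (splitAt m x)

module Submission where

-- Label the points by the orbits of the
-- group generated by δ₁ ⋯ δ_k.  Reading the δ's one at a time, each 3-cycle
-- (a b c) merges at most two labels, so some surjective labelling that is
-- invariant under every δᵢ uses at least n − 2k labels.  Invariant labels
-- are constant on orbits, so transitivity leaves only one label:
-- n ≤ 2k + 1.  By parity this gives k ≥ m for n = 2m+1 and k ≥ m+2 for
-- n = 2m+4.
--
-- If δ₁ ⋯ δ_k = σ on n+1 points,
-- then shifting every δᵢ two places up and appending τ = (0 2 1) gives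
-- k+1 three-cycles whose product is σ shifted by two, composed with τ, on
-- n+3 points; transitivity is kept since τ joins 0, 1 and 2.  Both target
-- permutations grow exactly this way, from the empty product on one point
-- and from (1 3 2)(0 2 1) = (0 1)(2 3) on four points respectively.

open import Defs
open import Data.Nat using (ℕ; zero; suc; _+_; _*_; _≤_; _≤?_; s≤s)
open import Data.Nat.Properties using (≤-refl; ≤-trans; ≤-reflexive; n≤1+n; +-identityʳ; +-monoˡ-≤; *-monoʳ-≤; *-suc; ≰⇒>; 1+n≰n)
open import Data.Nat.Tactic.RingSolver using (solve-∀)
open import Data.Fin using (Fin; zero; suc; fromℕ; inject₁; splitAt; lift; punchIn; punchOut)
open import Data.Fin.Properties using (_≟_; punchInᵢ≢i; punchOut-cong; punchOut-punchIn)
open import Data.Fin.Permutation using (Permutation′; _⟨$⟩ʳ_; _⟨$⟩ˡ_; permutation; inverseˡ; inverseʳ; lift₀)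
open import Data.Vec using (Vec; []; _∷_; lookup; map; _∷ʳ_)
open import Data.Vec.Properties using (lookup-map)
open import Data.Vec.Relation.Unary.All as All using (All; []; _∷_)
open import Data.Vec.Relation.Unary.All.Properties using (lookup⁺; gmap)
open import Data.Product using (Σ; ∃; _×_; _,_; proj₁; proj₂)
open import Data.Sum using (inj₁; inj₂)
open import Function.Bundles using (_↠_; Surjection; mk↠ₛ)
open import Function.Construct.Identity using (↠-id)
open import Function.Construct.Composition using (_↠-∘_)
open import Relation.Nullary using (yes; no; contradiction)
open import Relation.Binary.PropositionalEquality

private
  variable
    n n′ k k′ : ℕ

Reach-trans : {ds : Vec (Permutation′ n) k} {x y z : Fin n} →
              Reach ds x y → Reach ds y z → Reach ds x z
Reach-trans here      q = q
Reach-trans (fwd i p) q = fwd i (Reach-trans p q)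
Reach-trans (bwd i p) q = bwd i (Reach-trans p q)

Reach-sym : {ds : Vec (Permutation′ n) k} {x y : Fin n} → Reach ds x y → Reach ds y x
Reach-sym here = here
Reach-sym {ds = ds} (fwd i p) =
  Reach-trans (Reach-sym p) (subst (Reach ds _) (inverseˡ (lookup ds i)) (bwd i here))
Reach-sym {ds = ds} (bwd i p) =
  Reach-trans (Reach-sym p) (subst (Reach ds _) (inverseʳ (lookup ds i)) (fwd i here))

Reach-step : {ds : Vec (Permutation′ n) k} (i : Fin k) (x : Fin n) →
             Reach ds x (lookup ds i ⟨$⟩ʳ x)
Reach-step i x = fwd i here

transitive-via : {ds : Vec (Permutation′ n) k} (base : Fin n) →
                 (∀ x → Reach ds x base) → GenTransitive ds
transitive-via base r x y = Reach-trans (r x) (Reach-sym (r y))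

-- Intertwining the inverses
-- follows from intertwining the permutations themselves.
Reach-map : {ds : Vec (Permutation′ n) k} {ds′ : Vec (Permutation′ n′) k′}
            (h : Fin n → Fin n′) (ix : Fin k → Fin k′) →
            (∀ i x → lookup ds′ (ix i) ⟨$⟩ʳ h x ≡ h (lookup ds i ⟨$⟩ʳ x)) →
            ∀ {x y} → Reach ds x y → Reach ds′ (h x) (h y)
Reach-map h ix comm here = here
Reach-map {ds′ = ds′} h ix comm (fwd i p) =
  fwd (ix i) (subst (λ z → Reach ds′ z _) (sym (comm i _)) (Reach-map h ix comm p))
Reach-map {ds = ds} {ds′ = ds′} h ix comm {x} (bwd i p) =
  bwd (ix i) (subst (λ z → Reach ds′ z _) inverse-commutes (Reach-map h ix comm p))
  where
  δ : Permutation′ _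
  δ = lookup ds i
  δ′ : Permutation′ _
  δ′ = lookup ds′ (ix i)
  inverse-commutes : h (δ ⟨$⟩ˡ x) ≡ δ′ ⟨$⟩ˡ h x
  inverse-commutes = begin
    h (δ ⟨$⟩ˡ x)                  ≡⟨ inverseˡ δ′ ⟨
    δ′ ⟨$⟩ˡ (δ′ ⟨$⟩ʳ h (δ ⟨$⟩ˡ x)) ≡⟨ cong (δ′ ⟨$⟩ˡ_) (comm i _) ⟩
    δ′ ⟨$⟩ˡ h (δ ⟨$⟩ʳ (δ ⟨$⟩ˡ x)) ≡⟨ cong (λ z → δ′ ⟨$⟩ˡ h z) (inverseʳ δ) ⟩
    δ′ ⟨$⟩ˡ h x                   ∎
    where open ≡-Reasoning

Invariant : ∀ {r} → (Fin n → Fin r) → Vec (Permutation′ n) k → Set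
Invariant label ds = All (λ δ → ∀ x → label (δ ⟨$⟩ʳ x) ≡ label x) ds

invariant-on-orbits : ∀ {r} {ds : Vec (Permutation′ n) k} (label : Fin n → Fin r) →
                      Invariant label ds → ∀ {x y} → Reach ds x y → label x ≡ label y
invariant-on-orbits label inv here = refl
invariant-on-orbits label inv (fwd i p) =
  trans (sym (lookup⁺ inv i _)) (invariant-on-orbits label inv p)
invariant-on-orbits {ds = ds} label inv (bwd i p) =
  trans (trans (cong label (sym (inverseʳ (lookup ds i)))) (lookup⁺ inv i _))
        (invariant-on-orbits label inv p)

collapse : ∀ {r} {p q : Fin (suc r)} → q ≢ p → Fin (suc r) → Fin r
collapse {q = q} q≢p z with q ≟ z
... | yes _   = punchOut q≢p
... | no q≢z = punchOut q≢z

collapse-identifies : ∀ {r} {p q : Fin (suc r)} (q≢p : q ≢ p) → collapse q≢p p ≡ collapse q≢p q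
collapse-identifies {p = p} {q} q≢p with q ≟ p | q ≟ q
... | _     | no q≢q = contradiction refl q≢q
... | yes _ | yes _   = refl
... | no _  | yes _   = punchOut-cong q refl

collapse-onto : ∀ {r} {p q : Fin (suc r)} (q≢p : q ≢ p) (w : Fin r) → collapse q≢p (punchIn q w) ≡ w
collapse-onto {q = q} q≢p w with q ≟ punchIn q w
... | yes q≡ = contradiction (sym q≡) (punchInᵢ≢i q w)
... | no _   = trans (punchOut-cong q refl) (punchOut-punchIn q)

identify : ∀ {r} (p q : Fin r) →
           ∃ λ r′ → r ≤ suc r′ × Σ (Fin r ↠ Fin r′) λ M → Surjection.to M p ≡ Surjection.to M q
identify {r} p q with p ≟ q
... | yes p≡q = r , n≤1+n r , ↠-id (Fin r) , p≡q
identify {suc r} p q | no p≢q =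
  r , ≤-refl , mk↠ₛ {to = collapse q≢p} (λ w → punchIn q w , collapse-onto q≢p w) ,
  collapse-identifies q≢p
  where
  q≢p : q ≢ p
  q≢p q≡p = p≢q (sym q≡p)

record OrbitLabelling (ds : Vec (Permutation′ n) k) : Set where
  field
    labels      : ℕ
    labelling   : Fin n ↠ Fin labels
    invariant   : Invariant (Surjection.to labelling) ds
    many-labels : n ≤ labels + 2 * k

-- Arithmetic of one inductive step: two labels buy one more 3-cycle.
two-more : ∀ r k → suc (suc r) + 2 * k ≡ r + 2 * suc k
two-more = solve-∀

-- Each 3-cycle costs at most two labels.
orbitLabelling : (ds : Vec (Permutation′ n) k) → All IsThreeCycle ds → OrbitLabelling ds
orbitLabelling {n} [] [] = record
  { labels = n ; labelling = ↠-id (Fin n) ; invariant = [] ; many-labels = ≤-reflexive (sym (+-identityʳ n)) }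
orbitLabelling {n} {suc k} (δ ∷ ds) ((a , b , c , _ , _ , _ , δa , δb , δc , δ-fixes) ∷ cycles) =
  record { labels = r₂ ; labelling = L′ ; invariant = δ-invariant ∷ ds-invariant ; many-labels = bound }
  where
  open OrbitLabelling (orbitLabelling ds cycles) renaming (labels to r; labelling to L)
  ℓ = Surjection.to L
  merge₁ = identify (ℓ a) (ℓ b)
  M₁ = merge₁ .proj₂ .proj₂ .proj₁
  merge₂ = identify (Surjection.to M₁ (ℓ b)) (Surjection.to M₁ (ℓ c))
  r₂ = merge₂ .proj₁
  M₂ = merge₂ .proj₂ .proj₂ .proj₁
  L′ : Fin n ↠ Fin r₂
  L′ = M₂ ↠-∘ (M₁ ↠-∘ L)
  ℓ′ = Surjection.to L′
  ℓ′a≡ℓ′b : ℓ′ a ≡ ℓ′ b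
  ℓ′a≡ℓ′b = cong (Surjection.to M₂) (merge₁ .proj₂ .proj₂ .proj₂)
  ℓ′b≡ℓ′c : ℓ′ b ≡ ℓ′ c
  ℓ′b≡ℓ′c = merge₂ .proj₂ .proj₂ .proj₂
  δ-invariant : ∀ x → ℓ′ (δ ⟨$⟩ʳ x) ≡ ℓ′ x
  δ-invariant x with x ≟ a | x ≟ b | x ≟ c
  ... | yes refl | _        | _        = trans (cong ℓ′ δa) (sym ℓ′a≡ℓ′b)
  ... | no _     | yes refl | _        = trans (cong ℓ′ δb) (sym ℓ′b≡ℓ′c)
  ... | no _     | no _     | yes refl = trans (cong ℓ′ δc) (trans ℓ′a≡ℓ′b ℓ′b≡ℓ′c)
  ... | no x≢a   | no x≢b   | no x≢c   = cong ℓ′ (δ-fixes x x≢a x≢b x≢c)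
  ds-invariant : Invariant ℓ′ ds
  ds-invariant = All.map (λ inv x → cong (λ t → Surjection.to M₂ (Surjection.to M₁ t)) (inv x)) invariant
  bound : n ≤ r₂ + 2 * suc k
  bound = begin
    n                   ≤⟨ many-labels ⟩
    r + 2 * k           ≤⟨ +-monoˡ-≤ (2 * k) (≤-trans (merge₁ .proj₂ .proj₁) (s≤s (merge₂ .proj₂ .proj₁))) ⟩
    suc (suc r₂) + 2 * k ≡⟨ two-more r₂ k ⟩
    r₂ + 2 * suc k      ∎
    where open Data.Nat.Properties.≤-Reasoning

transitive-bound : {ds : Vec (Permutation′ n) k} →
                   All IsThreeCycle ds → GenTransitive ds → n ≤ suc (2 * k)
transitive-bound {ds = ds} cycles transitive with orbitLabelling ds cycles
... | record { labels = zero ; many-labels = h } = ≤-trans h (n≤1+n _)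
... | record { labels = suc zero ; many-labels = h } = h
... | record { labels = suc (suc r) ; labelling = L ; invariant = inv }
  with Surjection.strictlySurjective L zero | Surjection.strictlySurjective L (suc zero)
... | x , ℓx≡0 | y , ℓy≡1
  with trans (sym ℓx≡0) (trans (invariant-on-orbits (Surjection.to L) inv (transitive x y)) ℓy≡1)
... | ()

halve : ∀ a b → 2 * a ≤ suc (2 * b) → a ≤ b
halve a b h with a ≤? b
... | yes a≤b = a≤b
... | no a≰b = contradiction 2b+2≤2b+1 (1+n≰n {suc (2 * b)})
  where
  2b+2≤2b+1 : suc (suc (2 * b)) ≤ suc (2 * b)
  2b+2≤2b+1 = ≤-trans (≤-reflexive (sym (*-suc 2 b))) (≤-trans (*-monoʳ-≤ 2 (≰⇒> a≰b)) h)

μ³-lower-bound : ∀ {σ : Fin n → Fin n} {j} a → 2 * a ≤ n → Achievable σ j → a ≤ j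
μ³-lower-bound {j = j} a 2a≤n (ds , cycles , _ , transitive) =
  halve a j (≤-trans 2a≤n (transitive-bound cycles transitive))

prodAct-∷ʳ : (ds : Vec (Permutation′ n) k) (δ : Permutation′ n) (x : Fin n) →
             prodAct (ds ∷ʳ δ) x ≡ prodAct ds (δ ⟨$⟩ʳ x)
prodAct-∷ʳ []       δ x = refl
prodAct-∷ʳ (e ∷ ds) δ x = cong (e ⟨$⟩ʳ_) (prodAct-∷ʳ ds δ x)

lookup-∷ʳ-inject₁ : ∀ {A : Set} (xs : Vec A k) (y : A) (i : Fin k) → lookup (xs ∷ʳ y) (inject₁ i) ≡ lookup xs i
lookup-∷ʳ-inject₁ (x ∷ xs) y zero    = refl
lookup-∷ʳ-inject₁ (x ∷ xs) y (suc i) = lookup-∷ʳ-inject₁ xs y i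

lookup-∷ʳ-last : ∀ {A : Set} (xs : Vec A k) (y : A) → lookup (xs ∷ʳ y) (fromℕ k) ≡ y
lookup-∷ʳ-last []       y = refl
lookup-∷ʳ-last (x ∷ xs) y = lookup-∷ʳ-last xs y

All-∷ʳ : ∀ {A : Set} {P : A → Set} {xs : Vec A k} {y : A} → All P xs → P y → All P (xs ∷ʳ y)
All-∷ʳ []         py = py ∷ []
All-∷ʳ (px ∷ pxs) py = px ∷ All-∷ʳ pxs py

Reach-∷ʳ : {ds : Vec (Permutation′ n) k} (δ : Permutation′ n) {x y : Fin n} →
           Reach ds x y → Reach (ds ∷ʳ δ) x y
Reach-∷ʳ {ds = ds} δ = Reach-map (λ x → x) inject₁ (λ i x → cong (_⟨$⟩ʳ x) (lookup-∷ʳ-inject₁ ds δ i))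

lift₀-IsThreeCycle : {π : Permutation′ n} → IsThreeCycle π → IsThreeCycle (lift₀ π)
lift₀-IsThreeCycle {π = π} (a , b , c , a≢b , b≢c , a≢c , πa , πb , πc , π-fixes) =
  suc a , suc b , suc c , suc-≢ a≢b , suc-≢ b≢c , suc-≢ a≢c ,
  cong suc πa , cong suc πb , cong suc πc , fixes
  where
  suc-≢ : {x y : Fin _} → x ≢ y → suc x ≢ suc y
  suc-≢ x≢y refl = x≢y refl
  fixes : ∀ x → x ≢ suc a → x ≢ suc b → x ≢ suc c → lift₀ π ⟨$⟩ʳ x ≡ x
  fixes zero    _ _ _ = refl
  fixes (suc x) x≢a x≢b x≢c =
    cong suc (π-fixes x (λ e → x≢a (cong suc e)) (λ e → x≢b (cong suc e)) (λ e → x≢c (cong suc e)))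

lift-cong : {f g : Fin n → Fin n} → (∀ x → f x ≡ g x) → ∀ x → lift 1 f x ≡ lift 1 g x
lift-cong f≗g zero    = refl
lift-cong f≗g (suc x) = cong suc (f≗g x)

prodAct-lift₀ : (ds : Vec (Permutation′ n) k) (x : Fin (suc n)) → prodAct (map lift₀ ds) x ≡ lift 1 (prodAct ds) x
prodAct-lift₀ []       zero    = refl
prodAct-lift₀ []       (suc x) = refl
prodAct-lift₀ (δ ∷ ds) x = trans (cong (lift₀ δ ⟨$⟩ʳ_) (prodAct-lift₀ ds x)) (lift-step x)
  where
  lift-step : ∀ x → lift₀ δ ⟨$⟩ʳ lift 1 (prodAct ds) x ≡ lift 1 (prodAct (δ ∷ ds)) x
  lift-step zero    = refl
  lift-step (suc x) = refl

Reach-lift₀ : {ds : Vec (Permutation′ n) k} {x y : Fin n} → Reach ds x y → Reach (map lift₀ ds) (suc x) (suc y)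
Reach-lift₀ {ds = ds} = Reach-map suc (λ i → i) (λ i x → cong (_⟨$⟩ʳ suc x) (lookup-map i lift₀ ds))

τ-to τ-from : Fin (3 + n) → Fin (3 + n)
τ-to zero                = suc (suc zero)
τ-to (suc zero)          = zero
τ-to (suc (suc zero))    = suc zero
τ-to (suc (suc (suc x))) = suc (suc (suc x))
τ-from zero                = suc zero
τ-from (suc zero)          = suc (suc zero)
τ-from (suc (suc zero))    = zero
τ-from (suc (suc (suc x))) = suc (suc (suc x))

τ-to-from : (x : Fin (3 + n)) → τ-to (τ-from x) ≡ x
τ-to-from zero                = refl
τ-to-from (suc zero)          = refl
τ-to-from (suc (suc zero))    = refl
τ-to-from (suc (suc (suc x))) = refl

τ-from-to : (x : Fin (3 + n)) → τ-from (τ-to x) ≡ x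
τ-from-to zero                = refl
τ-from-to (suc zero)          = refl
τ-from-to (suc (suc zero))    = refl
τ-from-to (suc (suc (suc x))) = refl

τ : Permutation′ (3 + n)
τ = permutation τ-to τ-from τ-to-from τ-from-to

τ-IsThreeCycle : IsThreeCycle (τ {n})
τ-IsThreeCycle = zero , suc (suc zero) , suc zero , (λ ()) , (λ ()) , (λ ()) , refl , refl , refl , fixes
  where
  fixes : ∀ x → x ≢ zero → x ≢ suc (suc zero) → x ≢ suc zero → τ ⟨$⟩ʳ x ≡ x
  fixes zero                x≢0 _ _ = contradiction refl x≢0
  fixes (suc zero)          _ _ x≢1 = contradiction refl x≢1
  fixes (suc (suc zero))    _ x≢2 _ = contradiction refl x≢2
  fixes (suc (suc (suc x))) _ _ _   = refl

extension : (Fin (suc n) → Fin (suc n)) → Fin (3 + n) → Fin (3 + n)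
extension σ x = lift 1 (lift 1 σ) (τ ⟨$⟩ʳ x)

Achievable-resp : {σ σ′ : Fin n → Fin n} → (∀ x → σ x ≡ σ′ x) → Achievable σ k → Achievable σ′ k
Achievable-resp σ≗σ′ (ds , cycles , product , transitive) =
  ds , cycles , (λ x → trans (product x) (σ≗σ′ x)) , transitive

extend : {σ : Fin (suc n) → Fin (suc n)} → Achievable σ k → Achievable (extension σ) (suc k)
extend {n} {k} {σ} (ds , cycles , product , transitive) =
  ds′ , All-∷ʳ (gmap lift₀-IsThreeCycle (gmap lift₀-IsThreeCycle cycles)) τ-IsThreeCycle ,
  product′ , transitive-via zero reach-0
  where
  lifted : Vec (Permutation′ (3 + n)) k
  lifted = map lift₀ (map lift₀ ds)
  ds′ : Vec (Permutation′ (3 + n)) (suc k)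
  ds′ = lifted ∷ʳ τ
  lifted-once : ∀ y → prodAct (map lift₀ ds) y ≡ lift 1 σ y
  lifted-once y = trans (prodAct-lift₀ ds y) (lift-cong product y)
  product′ : ∀ x → prodAct ds′ x ≡ extension σ x
  product′ x = begin
    prodAct ds′ x                              ≡⟨ prodAct-∷ʳ lifted τ x ⟩
    prodAct lifted (τ ⟨$⟩ʳ x)                  ≡⟨ prodAct-lift₀ (map lift₀ ds) (τ ⟨$⟩ʳ x) ⟩
    lift 1 (prodAct (map lift₀ ds)) (τ ⟨$⟩ʳ x) ≡⟨ lift-cong lifted-once (τ ⟨$⟩ʳ x) ⟩
    extension σ x                              ∎
    where open ≡-Reasoning
  τ-step : ∀ x → Reach ds′ x (τ ⟨$⟩ʳ x)
  τ-step x = subst (λ δ → Reach ds′ x (δ ⟨$⟩ʳ x)) (lookup-∷ʳ-last lifted τ) (Reach-step (fromℕ k) x)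
  reach-0 : ∀ x → Reach ds′ x zero
  reach-0 zero          = here
  reach-0 (suc zero)    = τ-step (suc zero)
  reach-0 (suc (suc x)) =
    Reach-trans (Reach-∷ʳ τ (Reach-lift₀ (Reach-lift₀ (transitive x zero))))
                (Reach-trans (τ-step (suc (suc zero))) (reach-0 (suc zero)))

downCycle-extension : (x : Fin (3 + n)) → extension (downCycle {suc n}) x ≡ downCycle x
downCycle-extension zero                = refl
downCycle-extension (suc zero)          = refl
downCycle-extension (suc (suc zero))    = refl
downCycle-extension (suc (suc (suc x))) = refl

downCycle-achievable : ∀ m → Achievable (downCycle {suc (2 * m)}) m
downCycle-achievable zero = [] , [] , (λ { zero → refl }) , λ { zero zero → here }
downCycle-achievable (suc m) =
  subst (λ N → Achievable (downCycle {suc N}) (suc m)) (sym (*-suc 2 m))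
        (Achievable-resp downCycle-extension (extend (downCycle-achievable m)))

-- Likewise σ̃ on M+5 points extends σ̃ on M+3 points: the transposition of
-- the top two points is untouched.
tildeSigma-extension : ∀ {M} (x : Fin (3 + (M + 2))) →
                       extension (tildeSigma {suc M}) x ≡ tildeSigma {suc (suc (suc M))} x
tildeSigma-extension zero                = refl
tildeSigma-extension (suc zero)          = refl
tildeSigma-extension (suc (suc zero))    = refl
tildeSigma-extension {M} (suc (suc (suc x))) with splitAt M x
... | inj₁ _ = refl
... | inj₂ _ = refl

-- (0 1)(2 3) = (1 3 2)(0 2 1), a transitive product of two 3-cycles.
tildeSigma-base : Achievable (tildeSigma {2}) 2
tildeSigma-base =
  generators , lift₀-IsThreeCycle τ-IsThreeCycle ∷ τ-IsThreeCycle ∷ [] , product ,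
  transitive-via zero reach-0
  where
  generators : Vec (Permutation′ 4) 2
  generators = lift₀ τ ∷ τ ∷ []
  product : ∀ x → prodAct generators x ≡ tildeSigma {2} x
  product zero                   = refl
  product (suc zero)             = refl
  product (suc (suc zero))       = refl
  product (suc (suc (suc zero))) = refl
  reach-0 : ∀ x → Reach generators x zero
  reach-0 zero                   = here
  reach-0 (suc zero)             = fwd (suc zero) here
  reach-0 (suc (suc zero))       = fwd (suc zero) (fwd (suc zero) here)
  reach-0 (suc (suc (suc zero))) = fwd zero (fwd (suc zero) (fwd (suc zero) here))

tildeSigma-achievable : ∀ k → Achievable (tildeSigma {suc (suc (2 * k))}) (k + 2)
tildeSigma-achievable zero = tildeSigma-base
tildeSigma-achievable (suc k) =
  subst (λ N → Achievable (tildeSigma {suc (suc N)}) (suc k + 2)) (sym (*-suc 2 k))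
        (Achievable-resp tildeSigma-extension (extend (tildeSigma-achievable k)))

double-size : ∀ k → 2 * (k + 2) ≡ suc (suc (2 * k)) + 2
double-size = solve-∀

lemma4p8 : (∀ (m : ℕ) → Mu3Is (downCycle {suc (2 * m)}) m)
         × (∀ (k : ℕ) → Mu3Is (tildeSigma {suc (suc (2 * k))}) (k + 2))
lemma4p8 =
  (λ m → downCycle-achievable m , λ j → μ³-lower-bound m (n≤1+n (2 * m))) ,
  (λ k → tildeSigma-achievable k , λ j → μ³-lower-bound (k + 2) (≤-reflexive (double-size k)))
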